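{- For any connected, simple, undirected graph $\mathcal{G}$ with vertex set $V$ and edge set $E$, the linear coefficient $\gamma_1$ of the $\gamma$-polynomial of the $h^*$-polynomial of the symmetric edge polytope $P_{\mathcal{G}}$ satisfies $\gamma_1=2g$, where $g=|E|-|V|+1$.
   Context: For $v\in V$ let $\mathbf{v}$ be the standard basis vector of $\mathbb{R}^V$, and $P_{\mathcal{G}}=\mathrm{conv}\{\mathbf{u}-\mathbf{v},\mathbf{v}-\mathbf{u}: uv\in E\}$. For a $d$-dimensional lattice polytope $P\subset\mathbb{R}^n$, the Ehrhart series $\sum_{k\ge0}|kP\cap\mathbb{Z}^n|t^k$ equals $h^*(t)/(1-t)^{d+1}$ for a polynomial $h^*$, the $h^*$-polynomial. It is known that the $h^*$-polynomial of $P_{\mathcal{G}}$ is palindromic of degree $D=|V|-1$, so it can be written uniquely as $h^*(x)=\sum_{i=0}^{\lfloor D/2\rfloor}\gamma_i\,x^i(1+x)^{D-2i}$; the polynomial $\sum_i\gamma_i y^i$ is its $\gamma$-polynomial. -}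

module Defs where

open import Data.Bool using (Bool; true; false; if_then_else_; _∧_)
open import Data.Nat as ℕ using (ℕ; zero; suc; _∸_; _<ᵇ_)
open import Data.Nat.Combinatorics using (_C_)
open import Data.Integer as ℤ using (ℤ; +_)
open import Data.Rational as ℚ using (ℚ; 0ℚ)
open import Data.Fin using (Fin; toℕ; _≟_)
open import Data.List using (List; []; _∷_; concatMap; allFin; length; foldr; zipWith; map)
open import Data.List.Relation.Unary.All using (All)
open import Data.List.Relation.Unary.Unique.Propositional using (Unique)
open import Data.List.Membership.Propositional using (_∈_)
open import Data.Vec as Vec using (Vec; tabulate)
open import Data.Product using (Σ; _×_; _,_; ∃)
open import Relation.Binary.PropositionalEquality using (_≡_)
open import Relation.Nullary.Decidable using (⌊_⌋)
open import Function.Bundles using (_⇔_)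

record Graph (n : ℕ) : Set where
  field
    adj    : Fin n → Fin n → Bool
    sym    : ∀ u v → adj u v ≡ adj v u
    irrefl : ∀ u → adj u u ≡ false
open Graph public

data Walk {n : ℕ} (G : Graph n) : Fin n → Fin n → Set where
  here : ∀ {u} → Walk G u u
  step : ∀ {u v w} → adj G u v ≡ true → Walk G v w → Walk G u w

Connected : ∀ {n} → Graph n → Set
Connected {n} G = ∀ (u v : Fin n) → Walk G u v

edges : ∀ {n} → Graph n → List (Fin n × Fin n)
edges {n} G =
  concatMap (λ u → concatMap (λ v →
      if adj G u v ∧ (toℕ u <ᵇ toℕ v) then (u , v) ∷ [] else [])
    (allFin n)) (allFin n)

basis : ∀ {n} → Fin n → Vec ℤ n
basis v = tabulate (λ w → if ⌊ w ≟ v ⌋ then + 1 else + 0)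

_-ᵛ_ : ∀ {n} → Vec ℤ n → Vec ℤ n → Vec ℤ n
x -ᵛ y = Vec.zipWith ℤ._-_ x y

-- generating points of P_G : 𝐮 - 𝐯 and 𝐯 - 𝐮 for every edge uv,
-- together with the origin (which lies in P_G whenever E ≠ ∅; it only
-- matters for the one-vertex graph, where it gives P_G = {0}).
sepGenerators : ∀ {n} → Graph n → List (Vec ℤ n)
sepGenerators {n} G =
  Vec.replicate n (+ 0) ∷
  concatMap (λ { (u , v) → (basis u -ᵛ basis v) ∷ (basis v -ᵛ basis u) ∷ [] })
            (edges G)

toℚ : ℤ → ℚ
toℚ z = z ℚ./ 1

sumℚ : List ℚ → ℚ
sumℚ = foldr ℚ._+_ 0ℚ

InDilate : ∀ {n} → List (Vec ℤ n) → ℕ → Vec ℤ n → Set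
InDilate {n} gens k x =
  Σ (List ℚ) λ ls →
    (length ls ≡ length gens) ×
    All (ℚ._≤_ 0ℚ) ls ×
    (sumℚ ls ≡ toℚ (+ k)) ×
    (∀ (c : Fin n) →
       sumℚ (zipWith (λ l g → l ℚ.* toℚ (Vec.lookup g c)) ls gens)
         ≡ toℚ (Vec.lookup x c))

LatticeCount : ∀ {n} → List (Vec ℤ n) → ℕ → ℕ → Set
LatticeCount {n} gens k c =
  Σ (List (Vec ℤ n)) λ xs →
    Unique xs × (∀ x → (x ∈ xs ⇔ InDilate gens k x)) × (length xs ≡ c)

sumUpTo : ℕ → (ℕ → ℤ) → ℤ
sumUpTo zero    f = f 0
sumUpTo (suc m) f = sumUpTo m f ℤ.+ f (suc m)

sumBelow : ℕ → (ℕ → ℤ) → ℤ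
sumBelow zero    f = + 0
sumBelow (suc m) f = sumBelow m f ℤ.+ f m

coeff : List ℤ → ℕ → ℤ
coeff []       m       = + 0
coeff (a ∷ as) zero    = a
coeff (a ∷ as) (suc m) = coeff as m

sign : ℕ → ℤ
sign zero    = + 1
sign (suc j) = ℤ.- sign j

-- coefficient of t^m in (1 - t)^(d+1) · Σ_k L(k) t^k
ehrhartNumCoeff : ℕ → (ℕ → ℕ) → ℕ → ℤ
ehrhartNumCoeff d L m =
  sumUpTo m (λ j → sign j ℤ.* (+ (suc d C j)) ℤ.* (+ L (m ∸ j)))

-- coefficient of x^m in x^i (1+x)^(D-2i)
termCoeff : ℕ → ℕ → ℕ → ℕ
termCoeff D i m = if m ℕ.<ᵇ i then 0 else ((D ∸ (2 ℕ.* i)) C (m ∸ i))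

-- coefficient of x^m in Σ_i γ_i x^i (1+x)^(D-2i)
gammaExpandCoeff : ℕ → List ℤ → ℕ → ℤ
gammaExpandCoeff D γ m =
  sumBelow (length γ) (λ i → coeff γ i ℤ.* (+ termCoeff D i m))

{-# OPTIONS --safe #-}
-- Comparing the coefficients of t⁰ and t¹ in h*(t) = (1 - t)^(D+1) Σ_k L(k) t^k and in
-- Σ_i γ_i t^i (1 + t)^(D-2i) gives γ₀ = L(0) and D γ₀ + γ₁ = L(1) - (D + 1) L(0), so
-- γ₁ = L(1) - (2D + 1) L(0) with D = |V| - 1. Clearly L(0) = 1. The lattice points of P_G are
-- exactly its generators 0 and ±(𝐮 - 𝐯), uv ∈ E, so L(1) = 2|E| + 1 and γ₁ = 2(|E| - |V| + 1).
-- For the latter, write an integral x ∈ P_G as a convex combination of generators. Every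
-- coordinate of x lies in [-1, 1], and x_u = 1 forces every generator of positive weight to have
-- u-coordinate 1, i.e. to be of the form 𝐮 - 𝐛'. Fixing one of them, 𝐮 - 𝐛, the coordinate x_b is a
-- sum of nonpositive terms, one of them nonzero, hence x_b = -1; this forces every generator of
-- positive weight to be 𝐮 - 𝐛, so x = 𝐮 - 𝐛. Symmetrically, x_u = -1 yields a coordinate equal to 1.
module Submission where

open import Defs hiding (sym)
open import Data.Bool using (true; false; if_then_else_; _∧_; T)
open import Data.Fin as Fin using (Fin)
import Data.Fin.Properties as Fin
open import Data.Integer as ℤ using (ℤ; +_; 0ℤ; 1ℤ; -1ℤ; _-_; _+_; _*_)
import Data.Integer.Properties as ℤ
open import Data.Integer.GCD using (gcd-zeroʳ)
open import Data.Integer.Solver using (module +-*-Solver)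
open import Data.List using (List; []; _∷_; map; length; zip; zipWith; replicate; concatMap; allFin)
import Data.List.Properties as List
open import Data.List.Membership.Propositional using (_∈_; find)
open import Data.List.Membership.Propositional.Properties using (∈-concatMap⁻)
open import Data.List.Membership.Propositional.Properties.WithK using (unique∧set⇒bag)
open import Data.List.Relation.Binary.BagAndSetEquality using (∼bag⇒↭)
open import Data.List.Relation.Binary.Permutation.Propositional.Properties using (↭-length)
open import Data.List.Relation.Unary.All as All using (All; []; _∷_)
import Data.List.Relation.Unary.All.Properties as All
open import Data.List.Relation.Unary.AllPairs using ([]; _∷_)
open import Data.List.Relation.Unary.Any using (here; there)
open import Data.List.Relation.Unary.Unique.Propositional using (Unique)
import Data.List.Relation.Unary.Unique.Propositional.Properties as Unique
open import Data.Nat as ℕ using (ℕ; _≤_; _∸_; _/_)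
open import Data.Nat.Combinatorics using (_C_; nC1≡n)
import Data.Nat.Properties as ℕ
open import Data.Product using (∃-syntax; _×_; _,_; proj₁; proj₂)
open import Data.Rational as ℚ using (ℚ; 0ℚ; 1ℚ; ↥_; ↧_; *≤*)
import Data.Rational.Properties as ℚ
open import Data.Sum using (_⊎_; inj₁; inj₂)
open import Data.Unit using (tt)
open import Data.Vec as Vec using (Vec; lookup)
import Data.Vec.Properties as Vec
open import Function using (_∘_; _⇔_; mk⇔; Equivalence)
open import Relation.Binary.PropositionalEquality
open import Relation.Nullary using (¬_; yes; no; contradiction)
open import Relation.Nullary.Decidable using (⌊_⌋)

open +-*-Solver using (solve; _:=_; _:+_; _:-_; _:*_; con)

↥-toℚ : ∀ z → ↥ (toℚ z) ≡ z
↥-toℚ z = trans (sym (ℤ.*-identityʳ _)) (trans (cong (↥ (toℚ z) *_) (sym (gcd-zeroʳ z))) (ℚ.↥-/ z 1))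

↧-toℚ : ∀ z → ↧ (toℚ z) ≡ 1ℤ
↧-toℚ z = trans (sym (ℤ.*-identityʳ _)) (trans (cong (↧ (toℚ z) *_) (sym (gcd-zeroʳ z))) (ℚ.↧-/ z 1))

toℚ-injective : ∀ {a b} → toℚ a ≡ toℚ b → a ≡ b
toℚ-injective {a} {b} eq = trans (sym (↥-toℚ a)) (trans (cong ↥_ eq) (↥-toℚ b))

cross-toℚ : ∀ a b → ↥ (toℚ a) * ↧ (toℚ b) ≡ a
cross-toℚ a b = trans (cong₂ _*_ (↥-toℚ a) (↧-toℚ b)) (ℤ.*-identityʳ a)

toℚ-cancel-≤ : ∀ {a b} → toℚ a ℚ.≤ toℚ b → a ℤ.≤ b
toℚ-cancel-≤ {a} {b} (*≤* le) = subst₂ ℤ._≤_ (cross-toℚ a b) (cross-toℚ b a) le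

toℚ-mono-≤ : ∀ {a b} → a ℤ.≤ b → toℚ a ℚ.≤ toℚ b
toℚ-mono-≤ {a} {b} le = *≤* (subst₂ ℤ._≤_ (sym (cross-toℚ a b)) (sym (cross-toℚ b a)) le)

-- Sums of rational weights

sumℚ-zeros : ∀ {ls} → All (_≡ 0ℚ) ls → sumℚ ls ≡ 0ℚ
sumℚ-zeros []           = refl
sumℚ-zeros (refl ∷ ls≡0) = trans (ℚ.+-identityˡ _) (sumℚ-zeros ls≡0)

module _ {A : Set} where

  sumWith : (A → ℚ) → List A → ℚ
  sumWith f zs = sumℚ (map f zs)

  sumWith-mono-≤ : ∀ {f g : A → ℚ} zs → All (λ z → f z ℚ.≤ g z) zs → sumWith f zs ℚ.≤ sumWith g zs
  sumWith-mono-≤ []       []         = ℚ.≤-refl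
  sumWith-mono-≤ (z ∷ zs) (le ∷ les) = ℚ.+-mono-≤ le (sumWith-mono-≤ zs les)

  sumWith-tight : ∀ {f g : A → ℚ} zs → All (λ z → f z ℚ.≤ g z) zs →
                  sumWith f zs ≡ sumWith g zs → All (λ z → f z ≡ g z) zs
  sumWith-tight []       []         _  = []
  sumWith-tight {f} {g} (z ∷ zs) (le ∷ les) eq = head ∷ sumWith-tight zs les tail
    where
    rest : sumWith f zs ℚ.≤ sumWith g zs
    rest = sumWith-mono-≤ zs les
    head : f z ≡ g z
    head = ℚ.≤-antisym le (ℚ.≮⇒≥ (λ lt → ℚ.<-irrefl eq (ℚ.+-mono-<-≤ lt rest)))
    tail : sumWith f zs ≡ sumWith g zs
    tail = ℚ.≤-antisym rest (ℚ.≮⇒≥ (λ lt → ℚ.<-irrefl eq (ℚ.+-mono-≤-< le lt)))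

  sumWith-cong : ∀ {f g : A → ℚ} zs → All (λ z → f z ≡ g z) zs → sumWith f zs ≡ sumWith g zs
  sumWith-cong []       []         = refl
  sumWith-cong (z ∷ zs) (eq ∷ eqs) = cong₂ ℚ._+_ eq (sumWith-cong zs eqs)

  sumWith-zero : ∀ zs → sumWith (λ _ → 0ℚ) zs ≡ 0ℚ
  sumWith-zero []       = refl
  sumWith-zero (z ∷ zs) = trans (ℚ.+-identityˡ _) (sumWith-zero zs)

  sumWith-neg : ∀ (f : A → ℚ) zs → sumWith (ℚ.-_ ∘ f) zs ≡ ℚ.- sumWith f zs
  sumWith-neg f []       = refl
  sumWith-neg f (z ∷ zs) = trans (cong (ℚ.- f z ℚ.+_) (sumWith-neg f zs)) (sym (ℚ.neg-distrib-+ (f z) _))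

  sumWith-*ʳ : ∀ (f : A → ℚ) c zs → sumWith (λ z → f z ℚ.* c) zs ≡ sumWith f zs ℚ.* c
  sumWith-*ʳ f c []       = sym (ℚ.*-zeroˡ c)
  sumWith-*ʳ f c (z ∷ zs) = trans (cong (f z ℚ.* c ℚ.+_) (sumWith-*ʳ f c zs)) (sym (ℚ.*-distribʳ-+ c (f z) _))

  sumWith≢0⇒witness : ∀ (f : A → ℚ) zs → sumWith f zs ≢ 0ℚ → ∃[ z ] (z ∈ zs × f z ≢ 0ℚ)
  sumWith≢0⇒witness f []       s≢0 = contradiction refl s≢0
  sumWith≢0⇒witness f (z ∷ zs) s≢0 with f z ℚ.≟ 0ℚ
  ... | no fz≢0  = z , here refl , fz≢0
  ... | yes fz≡0 =
    let y , y∈ , fy≢0 = sumWith≢0⇒witness f zs (λ s≡0 → s≢0 (cong₂ ℚ._+_ fz≡0 s≡0))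
    in y , there y∈ , fy≢0

*-toℚ-1≡neg : ∀ w → w ℚ.* toℚ -1ℤ ≡ ℚ.- w
*-toℚ-1≡neg w = trans (sym (ℚ.neg-distribʳ-* w 1ℚ)) (cong ℚ.-_ (ℚ.*-identityʳ w))

data Trit : ℤ → Set where
  -1ᵗ : Trit -1ℤ
  0ᵗ  : Trit 0ℤ
  1ᵗ  : Trit 1ℤ

trit-from-bounds : ∀ {z} → -1ℤ ℤ.≤ z → z ℤ.≤ 1ℤ → Trit z
trit-from-bounds {+ 0}                _        _                          = 0ᵗ
trit-from-bounds {+ 1}                _        _                          = 1ᵗ
trit-from-bounds {+ ℕ.suc (ℕ.suc _)}  _        (ℤ.+≤+ (ℕ.s≤s ()))
trit-from-bounds { ℤ.-[1+ 0 ]}        _        _                          = -1ᵗ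
trit-from-bounds { ℤ.-[1+ ℕ.suc _ ]}  (ℤ.-≤- ()) _

trit-nonpos : ∀ {z} → Trit z → z ℤ.≤ 0ℤ → z ≢ 0ℤ → z ≡ -1ℤ
trit-nonpos -1ᵗ _          _   = refl
trit-nonpos 0ᵗ  _          z≢0 = contradiction refl z≢0
trit-nonpos 1ᵗ  (ℤ.+≤+ ()) _

trit-nonneg : ∀ {z} → Trit z → 0ℤ ℤ.≤ z → z ≢ 0ℤ → z ≡ 1ℤ
trit-nonneg 1ᵗ  _   _   = refl
trit-nonneg 0ᵗ  _   z≢0 = contradiction refl z≢0
trit-nonneg -1ᵗ ()  _

trit-nonzero : ∀ {z} → Trit z → z ≢ 0ℤ → z ≡ 1ℤ ⊎ z ≡ -1ℤ
trit-nonzero 1ᵗ  _   = inj₁ refl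
trit-nonzero 0ᵗ  z≢0 = contradiction refl z≢0
trit-nonzero -1ᵗ _   = inj₂ refl

module _ {w : ℚ} (w≥0 : 0ℚ ℚ.≤ w) where

  private
    -w≤0 : ℚ.- w ℚ.≤ 0ℚ
    -w≤0 = ℚ.neg-antimono-≤ w≥0

  *trit≤id : ∀ {v} → Trit v → w ℚ.* toℚ v ℚ.≤ w
  *trit≤id -1ᵗ rewrite *-toℚ-1≡neg w = ℚ.≤-trans -w≤0 w≥0
  *trit≤id 0ᵗ  rewrite ℚ.*-zeroʳ w = w≥0
  *trit≤id 1ᵗ  rewrite ℚ.*-identityʳ w = ℚ.≤-refl

  neg≤*trit : ∀ {v} → Trit v → ℚ.- w ℚ.≤ w ℚ.* toℚ v
  neg≤*trit -1ᵗ rewrite *-toℚ-1≡neg w = ℚ.≤-refl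
  neg≤*trit 0ᵗ  rewrite ℚ.*-zeroʳ w = -w≤0
  neg≤*trit 1ᵗ  rewrite ℚ.*-identityʳ w = ℚ.≤-trans -w≤0 w≥0

  *trit≡id : ∀ {v} → Trit v → w ℚ.* toℚ v ≡ w → w ≡ 0ℚ ⊎ v ≡ 1ℤ
  *trit≡id -1ᵗ eq rewrite *-toℚ-1≡neg w = inj₁ (ℚ.≤-antisym (subst (ℚ._≤ 0ℚ) eq -w≤0) w≥0)
  *trit≡id 0ᵗ  eq rewrite ℚ.*-zeroʳ w = inj₁ (sym eq)
  *trit≡id 1ᵗ  eq = inj₂ refl

  *trit≡neg : ∀ {v} → Trit v → w ℚ.* toℚ v ≡ ℚ.- w → w ≡ 0ℚ ⊎ v ≡ -1ℤ
  *trit≡neg -1ᵗ eq = inj₂ refl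
  *trit≡neg 0ᵗ  eq rewrite ℚ.*-zeroʳ w = inj₁ (ℚ.neg-injective (sym eq))
  *trit≡neg 1ᵗ  eq rewrite ℚ.*-identityʳ w = inj₁ (ℚ.≤-antisym (subst (ℚ._≤ 0ℚ) (sym eq) -w≤0) w≥0)

  *nonpos≤0 : ∀ {v} → v ℤ.≤ 0ℤ → w ℚ.* toℚ v ℚ.≤ 0ℚ
  *nonpos≤0 v≤0 = subst (w ℚ.* _ ℚ.≤_) (ℚ.*-zeroʳ w)
    (ℚ.*-monoˡ-≤-nonNeg w {{ℚ.nonNegative w≥0}} (toℚ-mono-≤ v≤0))

  0≤*nonneg : ∀ {v} → 0ℤ ℤ.≤ v → 0ℚ ℚ.≤ w ℚ.* toℚ v
  0≤*nonneg 0≤v = subst (ℚ._≤ w ℚ.* _) (ℚ.*-zeroʳ w)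
    (ℚ.*-monoˡ-≤-nonNeg w {{ℚ.nonNegative w≥0}} (toℚ-mono-≤ 0≤v))

-- The roots 𝐚 - 𝐛

lookup-extensional : ∀ {A : Set} {n} {x y : Vec A n} → (∀ c → lookup x c ≡ lookup y c) → x ≡ y
lookup-extensional {x = x} {y} eq =
  trans (sym (Vec.tabulate∘lookup x)) (trans (Vec.tabulate-cong eq) (Vec.tabulate∘lookup y))

module _ {n : ℕ} where

  δ : Fin n → Fin n → ℤ
  δ c a = if ⌊ c Fin.≟ a ⌋ then 1ℤ else 0ℤ

  δ-refl : ∀ a → δ a a ≡ 1ℤ
  δ-refl a with a Fin.≟ a
  ... | yes _   = refl
  ... | no a≢a = contradiction refl a≢a

  δ-≢ : ∀ {c a} → c ≢ a → δ c a ≡ 0ℤ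
  δ-≢ {c} {a} c≢a with c Fin.≟ a
  ... | yes c≡a = contradiction c≡a c≢a
  ... | no _    = refl

  origin : Vec ℤ n
  origin = Vec.replicate n 0ℤ

  arc : Fin n → Fin n → Vec ℤ n
  arc a b = basis a -ᵛ basis b

  lookup-arc : ∀ a b c → lookup (arc a b) c ≡ δ c a - δ c b
  lookup-arc a b c = trans (Vec.lookup-zipWith _-_ c (basis a) (basis b))
    (cong₂ _-_ (Vec.lookup∘tabulate _ c) (Vec.lookup∘tabulate _ c))

  lookup-arc-head : ∀ {a b} → a ≢ b → lookup (arc a b) a ≡ 1ℤ
  lookup-arc-head {a} {b} a≢b = trans (lookup-arc a b a) (cong₂ _-_ (δ-refl a) (δ-≢ a≢b))

  lookup-arc-tail : ∀ {a b} → a ≢ b → lookup (arc a b) b ≡ -1ℤ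
  lookup-arc-tail {a} {b} a≢b = trans (lookup-arc a b b) (cong₂ _-_ (δ-≢ (a≢b ∘ sym)) (δ-refl b))

  lookup-arc-≤0 : ∀ {a b c} → c ≢ a → lookup (arc a b) c ℤ.≤ 0ℤ
  lookup-arc-≤0 {a} {b} {c} c≢a rewrite lookup-arc a b c | δ-≢ c≢a with c Fin.≟ b
  ... | yes _ = ℤ.-≤+
  ... | no _  = ℤ.+≤+ ℕ.z≤n

  lookup-arc-≥0 : ∀ {a b c} → c ≢ b → 0ℤ ℤ.≤ lookup (arc a b) c
  lookup-arc-≥0 {a} {b} {c} c≢b rewrite lookup-arc a b c | δ-≢ c≢b with c Fin.≟ a
  ... | yes _ = ℤ.+≤+ ℕ.z≤n
  ... | no _  = ℤ.+≤+ ℕ.z≤n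

  lookup-arc≡1 : ∀ {a b c} → lookup (arc a b) c ≡ 1ℤ → c ≡ a
  lookup-arc≡1 {a} {b} {c} eq rewrite lookup-arc a b c with c Fin.≟ a | c Fin.≟ b
  ... | yes c≡a | _     = c≡a
  ... | no _    | yes _ with () ← eq
  ... | no _    | no _  with () ← eq

  lookup-arc≡-1 : ∀ {a b c} → lookup (arc a b) c ≡ -1ℤ → c ≡ b
  lookup-arc≡-1 {a} {b} {c} eq rewrite lookup-arc a b c with c Fin.≟ a | c Fin.≟ b
  ... | _     | yes c≡b = c≡b
  ... | yes _ | no _    with () ← eq
  ... | no _  | no _    with () ← eq

  arc-injective : ∀ {a b a′ b′} → a ≢ b → arc a b ≡ arc a′ b′ → a ≡ a′ × b ≡ b′
  arc-injective {a} {b} a≢b eq =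
    lookup-arc≡1  (trans (cong (λ g → lookup g a) (sym eq)) (lookup-arc-head a≢b)) ,
    lookup-arc≡-1 (trans (cong (λ g → lookup g b) (sym eq)) (lookup-arc-tail a≢b))

  data RootOrZero : Vec ℤ n → Set where
    zero : RootOrZero origin
    root : ∀ {a b} → a ≢ b → RootOrZero (arc a b)

  RootOrZero-trit : ∀ {g} → RootOrZero g → ∀ c → Trit (lookup g c)
  RootOrZero-trit zero c rewrite Vec.lookup-replicate c 0ℤ = 0ᵗ
  RootOrZero-trit (root {a} {b} a≢b) c rewrite lookup-arc a b c with c Fin.≟ a | c Fin.≟ b
  ... | yes refl | yes refl = contradiction refl a≢b
  ... | yes _    | no _     = 1ᵗ
  ... | no _     | yes _    = -1ᵗ
  ... | no _     | no _     = 0ᵗ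

  RootOrZero-≡1 : ∀ {g u} → RootOrZero g → lookup g u ≡ 1ℤ → ∃[ b ] (b ≢ u × g ≡ arc u b)
  RootOrZero-≡1 {u = u} zero eq with () ← trans (sym (Vec.lookup-replicate u 0ℤ)) eq
  RootOrZero-≡1 (root {a} {b} a≢b) eq with refl ← lookup-arc≡1 eq = b , a≢b ∘ sym , refl

  RootOrZero-≡-1 : ∀ {g u} → RootOrZero g → lookup g u ≡ -1ℤ → ∃[ a ] (a ≢ u × g ≡ arc a u)
  RootOrZero-≡-1 {u = u} zero eq with () ← trans (sym (Vec.lookup-replicate u 0ℤ)) eq
  RootOrZero-≡-1 (root {a} {b} a≢b) eq with refl ← lookup-arc≡-1 eq = a , a≢b , refl

-- Integral points in the convex hull of roots

module _ {n : ℕ} where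

  term : Fin n → ℚ × Vec ℤ n → ℚ
  term c (w , g) = w ℚ.* toℚ (lookup g c)

  OnSupport : (Vec ℤ n → Set) → List (ℚ × Vec ℤ n) → Set
  OnSupport P = All (λ (w , g) → w ≡ 0ℚ ⊎ P g)

  support-at : ∀ {P : Vec ℤ n → Set} {zs p} → OnSupport P zs → p ∈ zs → proj₁ p ≢ 0ℚ → P (proj₂ p)
  support-at supp p∈ w≢0 with All.lookup supp p∈
  ... | inj₁ w≡0 = contradiction w≡0 w≢0
  ... | inj₂ Pg  = Pg

module ConvexCombinationOfRoots {n : ℕ} (zs : List (ℚ × Vec ℤ n))
  (nonneg : All (λ (w , _) → 0ℚ ℚ.≤ w) zs)
  (roots  : All (λ (_ , g) → RootOrZero g) zs)
  (total  : sumWith proj₁ zs ≡ 1ℚ)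
  (x : Vec ℤ n)
  (coords : ∀ c → sumWith (term c) zs ≡ toℚ (lookup x c)) where

  private
    weighted-roots : All (λ (w , g) → 0ℚ ℚ.≤ w × RootOrZero g) zs
    weighted-roots = All.zip (nonneg , roots)

    pointwise : ∀ {R : ℚ × Vec ℤ n → Set} →
                (∀ {w g} → 0ℚ ℚ.≤ w → RootOrZero g → R (w , g)) → All R zs
    pointwise f = All.map (λ (w≥0 , r) → f w≥0 r) weighted-roots

    withRoots : ∀ {Q R : ℚ × Vec ℤ n → Set} →
                (∀ {w g} → 0ℚ ℚ.≤ w → RootOrZero g → Q (w , g) → R (w , g)) → All Q zs → All R zs
    withRoots f qs = All.zipWith (λ ((w≥0 , r) , q) → f w≥0 r q) (weighted-roots , qs)

    term≤weight : ∀ c → All (λ p → term c p ℚ.≤ proj₁ p) zs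
    term≤weight c = pointwise (λ w≥0 r → *trit≤id w≥0 (RootOrZero-trit r c))

    -weight≤term : ∀ c → All (λ p → ℚ.- proj₁ p ℚ.≤ term c p) zs
    -weight≤term c = pointwise (λ w≥0 r → neg≤*trit w≥0 (RootOrZero-trit r c))

    sum-neg-weight : sumWith (ℚ.-_ ∘ proj₁) zs ≡ ℚ.- 1ℚ
    sum-neg-weight = trans (sumWith-neg proj₁ zs) (cong ℚ.-_ total)

  coordinate-trit : ∀ c → Trit (lookup x c)
  coordinate-trit c = trit-from-bounds (toℚ-cancel-≤ lower) (toℚ-cancel-≤ upper)
    where
    upper : toℚ (lookup x c) ℚ.≤ 1ℚ
    upper = subst₂ ℚ._≤_ (coords c) total (sumWith-mono-≤ zs (term≤weight c))
    lower : ℚ.- 1ℚ ℚ.≤ toℚ (lookup x c)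
    lower = subst₂ ℚ._≤_ sum-neg-weight (coords c) (sumWith-mono-≤ zs (-weight≤term c))

  support-≡1 : ∀ {c} → lookup x c ≡ 1ℤ → OnSupport (λ g → lookup g c ≡ 1ℤ) zs
  support-≡1 {c} xc≡1 =
    withRoots (λ w≥0 r → *trit≡id w≥0 (RootOrZero-trit r c))
      (sumWith-tight zs (term≤weight c) (trans (coords c) (trans (cong toℚ xc≡1) (sym total))))

  support-≡-1 : ∀ {c} → lookup x c ≡ -1ℤ → OnSupport (λ g → lookup g c ≡ -1ℤ) zs
  support-≡-1 {c} xc≡-1 =
    withRoots (λ w≥0 r eq → *trit≡neg w≥0 (RootOrZero-trit r c) (sym eq))
      (sumWith-tight zs (-weight≤term c) (trans sum-neg-weight (sym (trans (coords c) (cong toℚ xc≡-1)))))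

  support-nonempty : ∃[ p ] (p ∈ zs × proj₁ p ≢ 0ℚ)
  support-nonempty = sumWith≢0⇒witness proj₁ zs (λ s≡0 → 1≢0 (trans (sym total) s≡0))
    where
    1≢0 : 1ℚ ≢ 0ℚ
    1≢0 ()

  coordinate≡-1 : ∀ {c p} → p ∈ zs → term c p ≢ 0ℚ → All (λ p → term c p ℚ.≤ 0ℚ) zs → lookup x c ≡ -1ℤ
  coordinate≡-1 {c} p∈ termp≢0 nonpos = trit-nonpos (coordinate-trit c) xc≤0 xc≢0
    where
    xc≤0 : lookup x c ℤ.≤ 0ℤ
    xc≤0 = toℚ-cancel-≤ (subst₂ ℚ._≤_ (coords c) (sumWith-zero zs) (sumWith-mono-≤ zs nonpos))
    xc≢0 : lookup x c ≢ 0ℤ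
    xc≢0 xc≡0 = termp≢0 (All.lookup (sumWith-tight zs nonpos
      (trans (coords c) (trans (cong toℚ xc≡0) (sym (sumWith-zero zs))))) p∈)

  coordinate≡1 : ∀ {c p} → p ∈ zs → term c p ≢ 0ℚ → All (λ p → 0ℚ ℚ.≤ term c p) zs → lookup x c ≡ 1ℤ
  coordinate≡1 {c} p∈ termp≢0 nonneg = trit-nonneg (coordinate-trit c) 0≤xc xc≢0
    where
    0≤xc : 0ℤ ℤ.≤ lookup x c
    0≤xc = toℚ-cancel-≤ (subst₂ ℚ._≤_ (sumWith-zero zs) (coords c) (sumWith-mono-≤ zs nonneg))
    xc≢0 : lookup x c ≢ 0ℤ
    xc≢0 xc≡0 = termp≢0 (sym (All.lookup (sumWith-tight zs nonneg
      (trans (sumWith-zero zs) (sym (trans (coords c) (cong toℚ xc≡0))))) p∈))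

  constant-support : ∀ {g} → OnSupport (_≡ g) zs → x ≡ g
  constant-support {g} supp = lookup-extensional (λ c → toℚ-injective (begin
    toℚ (lookup x c)                                ≡⟨ coords c ⟨
    sumWith (term c) zs                             ≡⟨ sumWith-cong zs (All.map (at c) supp) ⟩
    sumWith (λ p → proj₁ p ℚ.* toℚ (lookup g c)) zs ≡⟨ sumWith-*ʳ proj₁ _ zs ⟩
    sumWith proj₁ zs ℚ.* toℚ (lookup g c)           ≡⟨ cong (ℚ._* _) total ⟩
    1ℚ ℚ.* toℚ (lookup g c)                         ≡⟨ ℚ.*-identityˡ _ ⟩
    toℚ (lookup g c)                                ∎))
    where
    open ≡-Reasoning
    at : ∀ c {p} → proj₁ p ≡ 0ℚ ⊎ proj₂ p ≡ g → term c p ≡ proj₁ p ℚ.* toℚ (lookup g c)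
    at c {_ , h} (inj₁ refl) = trans (ℚ.*-zeroˡ (toℚ (lookup h c))) (sym (ℚ.*-zeroˡ (toℚ (lookup g c))))
    at c (inj₂ refl) = refl

  coordinate≡1⇒member : ∀ {u} → lookup x u ≡ 1ℤ → ∃[ p ] (p ∈ zs × proj₂ p ≡ x)
  coordinate≡1⇒member {u} xu≡1 with support-nonempty
  ... | (w , g) , p∈ , w≢0 with RootOrZero-≡1 (All.lookup roots p∈) (support-at (support-≡1 xu≡1) p∈ w≢0)
  ... | b , b≢u , refl = (w , arc u b) , p∈ , sym (constant-support equal)
    where
    heads : OnSupport (λ g → lookup g u ≡ 1ℤ) zs
    heads = support-≡1 xu≡1

    b-nonpos : All (λ p → term b p ℚ.≤ 0ℚ) zs
    b-nonpos = withRoots nonpos heads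
      where
      nonpos : ∀ {w g} → 0ℚ ℚ.≤ w → RootOrZero g → w ≡ 0ℚ ⊎ lookup g u ≡ 1ℤ → term b (w , g) ℚ.≤ 0ℚ
      nonpos {g = g} _ _ (inj₁ refl) = ℚ.≤-reflexive (ℚ.*-zeroˡ (toℚ (lookup g b)))
      nonpos w≥0 r (inj₂ gu≡1) with RootOrZero-≡1 r gu≡1
      ... | _ , _ , refl = *nonpos≤0 w≥0 (lookup-arc-≤0 b≢u)

    term-b≢0 : term b (w , arc u b) ≢ 0ℚ
    term-b≢0 eq = w≢0 (ℚ.neg-injective (begin
      ℚ.- w                                ≡⟨ *-toℚ-1≡neg w ⟨
      w ℚ.* toℚ -1ℤ                        ≡⟨ cong (λ z → w ℚ.* toℚ z) (lookup-arc-tail (b≢u ∘ sym)) ⟨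
      w ℚ.* toℚ (lookup (arc u b) b)       ≡⟨ eq ⟩
      0ℚ                                   ∎))
      where open ≡-Reasoning

    tails : OnSupport (λ g → lookup g b ≡ -1ℤ) zs
    tails = support-≡-1 (coordinate≡-1 p∈ term-b≢0 b-nonpos)

    equal : OnSupport (_≡ arc u b) zs
    equal = withRoots same (All.zip (heads , tails))
      where
      same : ∀ {w g} → 0ℚ ℚ.≤ w → RootOrZero g →
             (w ≡ 0ℚ ⊎ lookup g u ≡ 1ℤ) × (w ≡ 0ℚ ⊎ lookup g b ≡ -1ℤ) → w ≡ 0ℚ ⊎ g ≡ arc u b
      same _ _ (inj₁ w≡0 , _)        = inj₁ w≡0
      same _ _ (inj₂ _   , inj₁ w≡0) = inj₁ w≡0
      same _ r (inj₂ gu≡1 , inj₂ gb≡-1) with RootOrZero-≡1 r gu≡1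
      ... | b′ , _ , refl with refl ← lookup-arc≡-1 {a = u} {b = b′} {c = b} gb≡-1 = inj₂ refl

  coordinate≡-1⇒coordinate≡1 : ∀ {u} → lookup x u ≡ -1ℤ → ∃[ a ] lookup x a ≡ 1ℤ
  coordinate≡-1⇒coordinate≡1 {u} xu≡-1 with support-nonempty
  ... | (w , g) , p∈ , w≢0 with RootOrZero-≡-1 (All.lookup roots p∈) (support-at (support-≡-1 xu≡-1) p∈ w≢0)
  ... | a , a≢u , refl = a , coordinate≡1 p∈ term-a≢0 a-nonneg
    where
    a-nonneg : All (λ p → 0ℚ ℚ.≤ term a p) zs
    a-nonneg = withRoots nonneg′ (support-≡-1 xu≡-1)
      where
      nonneg′ : ∀ {w g} → 0ℚ ℚ.≤ w → RootOrZero g → w ≡ 0ℚ ⊎ lookup g u ≡ -1ℤ → 0ℚ ℚ.≤ term a (w , g)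
      nonneg′ {g = g} _ _ (inj₁ refl) = ℚ.≤-reflexive (sym (ℚ.*-zeroˡ (toℚ (lookup g a))))
      nonneg′ w≥0 r (inj₂ gu≡-1) with RootOrZero-≡-1 r gu≡-1
      ... | _ , _ , refl = 0≤*nonneg w≥0 (lookup-arc-≥0 a≢u)

    term-a≢0 : term a (w , arc a u) ≢ 0ℚ
    term-a≢0 eq = w≢0 (begin
      w                                    ≡⟨ ℚ.*-identityʳ w ⟨
      w ℚ.* toℚ 1ℤ                         ≡⟨ cong (λ z → w ℚ.* toℚ z) (lookup-arc-head a≢u) ⟨
      w ℚ.* toℚ (lookup (arc a u) a)       ≡⟨ eq ⟩
      0ℚ                                   ∎)
      where open ≡-Reasoning

  classify : x ≡ origin ⊎ ∃[ p ] (p ∈ zs × proj₂ p ≡ x)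
  classify with Fin.all? (λ c → lookup x c ℤ.≟ 0ℤ)
  ... | yes x≡0 = inj₁ (lookup-extensional (λ c → trans (x≡0 c) (sym (Vec.lookup-replicate c 0ℤ))))
  ... | no x≢0 with Fin.¬∀⟶∃¬ n _ (λ c → lookup x c ℤ.≟ 0ℤ) x≢0
  ... | c , xc≢0 with trit-nonzero (coordinate-trit c) xc≢0
  ... | inj₁ xc≡1  = inj₂ (coordinate≡1⇒member xc≡1)
  ... | inj₂ xc≡-1 = inj₂ (coordinate≡1⇒member (proj₂ (coordinate≡-1⇒coordinate≡1 xc≡-1)))

-- Lattice points of 0·P and 1·P

module _ {A B : Set} where

  map-proj₁-zip : ∀ (as : List A) (bs : List B) → length as ≡ length bs → map proj₁ (zip as bs) ≡ as
  map-proj₁-zip []       []       _   = refl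
  map-proj₁-zip (a ∷ as) (b ∷ bs) len = cong (a ∷_) (map-proj₁-zip as bs (ℕ.suc-injective len))

  All-zip⁺ˡ : ∀ {P : A → Set} {as} (bs : List B) → All P as → All (P ∘ proj₁) (zip as bs)
  All-zip⁺ˡ _        []         = []
  All-zip⁺ˡ []       (_ ∷ _)    = []
  All-zip⁺ˡ (b ∷ bs) (pa ∷ pas) = pa ∷ All-zip⁺ˡ bs pas

  All-zip⁺ʳ : ∀ {Q : B → Set} (as : List A) {bs} → All Q bs → All (Q ∘ proj₂) (zip as bs)
  All-zip⁺ʳ []       _          = []
  All-zip⁺ʳ (a ∷ as) []         = []
  All-zip⁺ʳ (a ∷ as) (qb ∷ qbs) = qb ∷ All-zip⁺ʳ as qbs

  ∈-zip⁻ʳ : ∀ (as : List A) (bs : List B) {p} → p ∈ zip as bs → proj₂ p ∈ bs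
  ∈-zip⁻ʳ (a ∷ as) (b ∷ bs) (here refl) = here refl
  ∈-zip⁻ʳ (a ∷ as) (b ∷ bs) (there p∈)  = there (∈-zip⁻ʳ as bs p∈)

module _ {n : ℕ} where

  sum-zipWith≡sumWith-term : ∀ c ls (gs : List (Vec ℤ n)) →
    sumℚ (zipWith (λ l g → l ℚ.* toℚ (lookup g c)) ls gs) ≡ sumWith (term c) (zip ls gs)
  sum-zipWith≡sumWith-term c ls gs = cong sumℚ (sym (List.map-zipWith _,_ (term c) ls gs))

  sumWith-term-zero : ∀ c {zs : List (ℚ × Vec ℤ n)} → All (λ p → proj₁ p ≡ 0ℚ) zs → sumWith (term c) zs ≡ 0ℚ
  sumWith-term-zero c {zs} w≡0 = trans (sumWith-cong zs (All.map (λ {p} → vanish {p}) w≡0)) (sumWith-zero zs)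
    where
    vanish : ∀ {p} → proj₁ p ≡ 0ℚ → term c p ≡ 0ℚ
    vanish {_ , g} refl = ℚ.*-zeroˡ (toℚ (lookup g c))

  origin∈dilate-zero : ∀ (gs : List (Vec ℤ n)) → InDilate gs 0 origin
  origin∈dilate-zero gs =
    zeros , List.length-replicate (length gs) , All.replicate⁺ (length gs) ℚ.≤-refl , sumℚ-zeros zeros≡0 ,
    λ c → trans (sum-zipWith≡sumWith-term c zeros gs)
            (trans (sumWith-term-zero c (All-zip⁺ˡ gs zeros≡0)) (cong toℚ (sym (Vec.lookup-replicate c 0ℤ))))
    where
    zeros : List ℚ
    zeros = replicate (length gs) 0ℚ
    zeros≡0 : All (_≡ 0ℚ) zeros
    zeros≡0 = All.replicate⁺ (length gs) refl

  private
    weights-total : ∀ (gs : List (Vec ℤ n)) {k x} (P : InDilate gs k x) →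
                    sumWith proj₁ (zip (proj₁ P) gs) ≡ toℚ (+ k)
    weights-total gs (ls , len , _ , total , _) = trans (cong sumℚ (map-proj₁-zip ls gs len)) total

    coordinates : ∀ (gs : List (Vec ℤ n)) {k} x (P : InDilate gs k x) →
                  ∀ c → sumWith (term c) (zip (proj₁ P) gs) ≡ toℚ (lookup x c)
    coordinates gs x (ls , _ , _ , _ , coords) c = trans (sym (sum-zipWith≡sumWith-term c ls gs)) (coords c)

  dilate-zero⇒origin : ∀ {gs : List (Vec ℤ n)} {x} → InDilate gs 0 x → x ≡ origin
  dilate-zero⇒origin {gs} {x} P@(ls , _ , nonneg , _ , _) =
    lookup-extensional (λ c → toℚ-injective (begin
      toℚ (lookup x c)          ≡⟨ coordinates gs {0} x P c ⟨
      sumWith (term c) (zip ls gs) ≡⟨ sumWith-term-zero c weights≡0 ⟩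
      0ℚ                        ≡⟨ cong toℚ (Vec.lookup-replicate c 0ℤ) ⟨
      toℚ (lookup origin c)     ∎))
    where
    open ≡-Reasoning
    weights≡0 : All (λ p → proj₁ p ≡ 0ℚ) (zip ls gs)
    weights≡0 = All.map sym (sumWith-tight (zip ls gs) (All-zip⁺ˡ gs nonneg)
      (trans (sumWith-zero (zip ls gs)) (sym (weights-total gs {0} {x} P))))

  member⇒dilate-one : ∀ {gs : List (Vec ℤ n)} {g} → g ∈ gs → InDilate gs 1 g
  member⇒dilate-one {_ ∷ gs} {g} (here refl) =
    1ℚ ∷ zeros , cong ℕ.suc (List.length-replicate (length gs)) ,
    *≤* (ℤ.+≤+ ℕ.z≤n) ∷ All.replicate⁺ (length gs) ℚ.≤-refl ,
    trans (cong (1ℚ ℚ.+_) (sumℚ-zeros zeros≡0)) (ℚ.+-identityʳ 1ℚ) ,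
    λ c → trans (cong₂ ℚ._+_ (ℚ.*-identityˡ (toℚ (lookup g c)))
                  (trans (sum-zipWith≡sumWith-term c zeros gs) (sumWith-term-zero c (All-zip⁺ˡ gs zeros≡0))))
                (ℚ.+-identityʳ _)
    where
    zeros : List ℚ
    zeros = replicate (length gs) 0ℚ
    zeros≡0 : All (_≡ 0ℚ) zeros
    zeros≡0 = All.replicate⁺ (length gs) refl
  member⇒dilate-one {h ∷ gs} (there g∈) =
    let ls , len , nonneg , total , coords = member⇒dilate-one {gs} g∈ in
    0ℚ ∷ ls , cong ℕ.suc len , ℚ.≤-refl ∷ nonneg , trans (ℚ.+-identityˡ _) total ,
    λ c → trans (cong₂ ℚ._+_ (ℚ.*-zeroˡ (toℚ (lookup h c))) (coords c)) (ℚ.+-identityˡ _)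

  dilate-one⇒member : ∀ {gs : List (Vec ℤ n)} → All RootOrZero gs → origin ∈ gs →
                      ∀ {x} → InDilate gs 1 x → x ∈ gs
  dilate-one⇒member {gs} roots origin∈ {x} P@(ls , _ , nonneg , _ , _)
    with ConvexCombinationOfRoots.classify (zip ls gs) (All-zip⁺ˡ gs nonneg) (All-zip⁺ʳ ls roots)
           (weights-total gs {1} {x} P) x (coordinates gs {1} x P)
  ... | inj₁ refl              = origin∈
  ... | inj₂ (_ , p∈ , refl) = ∈-zip⁻ʳ ls gs p∈

-- Edges and generators of P_G

module _ {A B : Set} where

  All-concatMap⁺ : ∀ {P : B → Set} {f : A → List B} {xs} →
                   (∀ {x} → x ∈ xs → All P (f x)) → All P (concatMap f xs)
  All-concatMap⁺ h = All.concat⁺ (All.map⁺ (All.tabulate h))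

  Unique-concatMap⁺ : (owner : B → A → Set) → (∀ {y x x′} → owner y x → owner y x′ → x ≡ x′) →
    ∀ {f : A → List B} {xs} → Unique xs →
    (∀ {x} → x ∈ xs → Unique (f x) × All (λ y → owner y x) (f x)) → Unique (concatMap f xs)
  Unique-concatMap⁺ owner owner-unique []                  _    = []
  Unique-concatMap⁺ owner owner-unique {f} {x ∷ xs} (x∉xs ∷ unique-xs) spec =
    Unique.++⁺ (proj₁ (spec (here refl))) (Unique-concatMap⁺ owner owner-unique unique-xs (spec ∘ there)) disjoint
    where
    disjoint : ∀ {y} → ¬ (y ∈ f x × y ∈ concatMap f xs)
    disjoint (y∈fx , y∈rest) =
      let x′ , x′∈xs , y∈fx′ = find (∈-concatMap⁻ f y∈rest)
      in All.lookup x∉xs x′∈xs (owner-unique (All.lookup (proj₂ (spec (here refl))) y∈fx)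
                                              (All.lookup (proj₂ (spec (there x′∈xs))) y∈fx′))

module _ {n : ℕ} (G : Graph n) where

  private
    candidate : Fin n → Fin n → List (Fin n × Fin n)
    candidate u v = if adj G u v ∧ (Fin.toℕ u ℕ.<ᵇ Fin.toℕ v) then (u , v) ∷ [] else []

    row : Fin n → List (Fin n × Fin n)
    row u = concatMap (candidate u) (allFin n)

    candidate-spec : ∀ u v → Unique (candidate u v) × All (λ e → e ≡ (u , v) × u Fin.< v) (candidate u v)
    candidate-spec u v with adj G u v | Fin.toℕ u ℕ.<ᵇ Fin.toℕ v in u<ᵇv
    ... | false | _     = [] , []
    ... | true  | false = [] , []
    ... | true  | true  = [] ∷ [] , (refl , ℕ.<ᵇ⇒< (Fin.toℕ u) (Fin.toℕ v) (subst T (sym u<ᵇv) tt)) ∷ []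

    candidate-owned : ∀ u v → All (λ e → proj₁ e ≡ u × proj₂ e ≡ v) (candidate u v)
    candidate-owned u v = All.map (λ { (refl , _) → refl , refl }) (proj₂ (candidate-spec u v))

    row-unique : ∀ u → Unique (row u)
    row-unique u = Unique-concatMap⁺ (λ e v → proj₂ e ≡ v) (λ p q → trans (sym p) q) {f = candidate u} {xs = allFin n}
      (Unique.allFin⁺ n) (λ {v} _ → proj₁ (candidate-spec u v) , All.map proj₂ (candidate-owned u v))

    row-owned : ∀ u → All (λ e → proj₁ e ≡ u) (row u)
    row-owned u = All-concatMap⁺ {f = candidate u} {xs = allFin n} (λ {v} _ → All.map proj₁ (candidate-owned u v))

  edges-ordered : All (λ (u , v) → u Fin.< v) (edges G)
  edges-ordered = All-concatMap⁺ {f = row} {xs = allFin n} λ {u} _ →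
    All-concatMap⁺ {f = candidate u} {xs = allFin n} λ {v} _ → All.map (λ { (refl , u<v) → u<v }) (proj₂ (candidate-spec u v))

  edges-unique : Unique (edges G)
  edges-unique = Unique-concatMap⁺ (λ e u → proj₁ e ≡ u) (λ p q → trans (sym p) q) {f = row} {xs = allFin n}
    (Unique.allFin⁺ n) (λ {u} _ → row-unique u , row-owned u)

  private
    both-arcs : Fin n × Fin n → List (Vec ℤ n)
    both-arcs (u , v) = arc u v ∷ arc v u ∷ []

    Carries : Vec ℤ n → Fin n × Fin n → Set
    Carries g (u , v) = u Fin.< v × (g ≡ arc u v ⊎ g ≡ arc v u)

    carrier-unique : ∀ {g e e′} → Carries g e → Carries g e′ → e ≡ e′
    carrier-unique (u<v , inj₁ refl) (u′<v′ , inj₁ eq) with refl , refl ← arc-injective (Fin.<⇒≢ u<v) eq = refl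
    carrier-unique (u<v , inj₁ refl) (u′<v′ , inj₂ eq) with refl , refl ← arc-injective (Fin.<⇒≢ u<v) eq =
      contradiction u<v (Fin.<-asym u′<v′)
    carrier-unique (u<v , inj₂ refl) (u′<v′ , inj₁ eq) with refl , refl ← arc-injective (Fin.<⇒≢ u<v ∘ sym) eq =
      contradiction u<v (Fin.<-asym u′<v′)
    carrier-unique (u<v , inj₂ refl) (u′<v′ , inj₂ eq) with refl , refl ← arc-injective (Fin.<⇒≢ u<v ∘ sym) eq = refl

    arc≢origin : ∀ {a b : Fin n} → a ≢ b → arc a b ≢ origin
    arc≢origin {a} a≢b eq with () ← trans (sym (lookup-arc-head a≢b)) (trans (cong (λ g → lookup g a) eq)
                                                                            (Vec.lookup-replicate a 0ℤ))

  sepGenerators-roots : All RootOrZero (sepGenerators G)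
  sepGenerators-roots = zero ∷ All-concatMap⁺ {f = both-arcs} λ e∈ →
    let u≢v = Fin.<⇒≢ (All.lookup edges-ordered e∈) in root u≢v ∷ root (u≢v ∘ sym) ∷ []

  sepGenerators-unique : Unique (sepGenerators G)
  sepGenerators-unique =
    All-concatMap⁺ {f = both-arcs} (λ e∈ →
      let u≢v = Fin.<⇒≢ (All.lookup edges-ordered e∈) in
      arc≢origin u≢v ∘ sym ∷ arc≢origin (u≢v ∘ sym) ∘ sym ∷ []) ∷
    Unique-concatMap⁺ Carries carrier-unique {f = both-arcs} edges-unique (λ e∈ →
      let u<v = All.lookup edges-ordered e∈ in
      ((λ eq → Fin.<⇒≢ u<v (proj₁ (arc-injective (Fin.<⇒≢ u<v) eq))) ∷ []) ∷ [] ∷ [] ,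
      (u<v , inj₁ refl) ∷ (u<v , inj₂ refl) ∷ [])

  length-sepGenerators : length (sepGenerators G) ≡ 1 ℕ.+ 2 ℕ.* length (edges G)
  length-sepGenerators = cong ℕ.suc (length-both-arcs (edges G))
    where
    length-both-arcs : ∀ es → length (concatMap both-arcs es) ≡ 2 ℕ.* length es
    length-both-arcs []       = refl
    length-both-arcs (e ∷ es) = trans (cong (2 ℕ.+_) (length-both-arcs es)) (sym (ℕ.*-distribˡ-+ 2 1 (length es)))

module _ {n : ℕ} {gens : List (Vec ℤ n)} {k c : ℕ} where

  latticeCount≡length : ∀ {ys} → Unique ys → (∀ x → x ∈ ys ⇔ InDilate gens k x) → LatticeCount gens k c → c ≡ length ys
  latticeCount≡length ys-unique ys-spec (xs , xs-unique , xs-spec , len) =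
    trans (sym len) (↭-length (∼bag⇒↭ (unique∧set⇒bag xs-unique ys-unique (λ {x} →
      mk⇔ (Equivalence.from (ys-spec x) ∘ Equivalence.to (xs-spec x))
          (Equivalence.from (xs-spec x) ∘ Equivalence.to (ys-spec x))))))

latticeCount-zero : ∀ {n} {gens : List (Vec ℤ n)} {c} → LatticeCount gens 0 c → c ≡ 1
latticeCount-zero {gens = gens} = latticeCount≡length {gens = gens} {k = 0} ([] ∷ [])
  (λ x → mk⇔ (λ { (here refl) → origin∈dilate-zero gens }) (λ P → here (dilate-zero⇒origin {gs = gens} {x} P)))

latticeCount-one : ∀ {n} (G : Graph n) {c} → LatticeCount (sepGenerators G) 1 c → c ≡ 1 ℕ.+ 2 ℕ.* length (edges G)
latticeCount-one G lc = trans
  (latticeCount≡length {gens = sepGenerators G} {k = 1} (sepGenerators-unique G)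
    (λ x → mk⇔ member⇒dilate-one (dilate-one⇒member (sepGenerators-roots G) (here refl) {x})) lc)
  (length-sepGenerators G)

-- Low coefficients of h* and of its γ-expansion

coeff-beyond : ∀ γ {i} → length γ ℕ.≤ i → coeff γ i ≡ 0ℤ
coeff-beyond []      _            = refl
coeff-beyond (a ∷ γ) (ℕ.s≤s len≤i) = coeff-beyond γ len≤i

sumBelow-stable : ∀ {f : ℕ → ℤ} k → (∀ i → k ℕ.≤ i → f i ≡ 0ℤ) → ∀ j → sumBelow (j ℕ.+ k) f ≡ sumBelow k f
sumBelow-stable     k vanish ℕ.zero    = refl
sumBelow-stable {f} k vanish (ℕ.suc j) =
  trans (cong₂ _+_ (sumBelow-stable k vanish j) (vanish (j ℕ.+ k) (ℕ.m≤n+m k j))) (ℤ.+-identityʳ _)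

termCoeff-above : ∀ D {i m} → m ℕ.< i → termCoeff D i m ≡ 0
termCoeff-above D {i} {m} m<i with m ℕ.<ᵇ i | ℕ.<⇒<ᵇ m<i
... | true | _ = refl

gammaExpandCoeff-truncate : ∀ D γ m →
  gammaExpandCoeff D γ m ≡ sumBelow (ℕ.suc m) (λ i → coeff γ i * + termCoeff D i m)
gammaExpandCoeff-truncate D γ m = begin
  sumBelow (length γ) f                    ≡⟨ sumBelow-stable (length γ) beyond-γ (ℕ.suc m) ⟨
  sumBelow (ℕ.suc m ℕ.+ length γ) f        ≡⟨ cong (λ k → sumBelow k f) (ℕ.+-comm (ℕ.suc m) (length γ)) ⟩
  sumBelow (length γ ℕ.+ ℕ.suc m) f        ≡⟨ sumBelow-stable (ℕ.suc m) beyond-m (length γ) ⟩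
  sumBelow (ℕ.suc m) f                     ∎
  where
  open ≡-Reasoning
  f : ℕ → ℤ
  f i = coeff γ i * + termCoeff D i m
  beyond-γ : ∀ i → length γ ℕ.≤ i → f i ≡ 0ℤ
  beyond-γ i len≤i = cong (_* + termCoeff D i m) (coeff-beyond γ len≤i)
  beyond-m : ∀ i → ℕ.suc m ℕ.≤ i → f i ≡ 0ℤ
  beyond-m i m<i = trans (cong (λ t → coeff γ i * + t) (termCoeff-above D m<i)) (ℤ.*-zeroʳ (coeff γ i))

gammaExpandCoeff-0 : ∀ D γ → gammaExpandCoeff D γ 0 ≡ coeff γ 0
gammaExpandCoeff-0 D γ = trans (gammaExpandCoeff-truncate D γ 0)
  (trans (ℤ.+-identityˡ _) (ℤ.*-identityʳ (coeff γ 0)))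

gammaExpandCoeff-1 : ∀ D γ → gammaExpandCoeff D γ 1 ≡ coeff γ 0 * + D + coeff γ 1
gammaExpandCoeff-1 D γ = trans (gammaExpandCoeff-truncate D γ 1)
  (cong₂ _+_ (trans (ℤ.+-identityˡ _) (cong (λ t → coeff γ 0 * + t) (nC1≡n D))) (ℤ.*-identityʳ (coeff γ 1)))

ehrhartNumCoeff-0 : ∀ d L → ehrhartNumCoeff d L 0 ≡ + L 0
ehrhartNumCoeff-0 d L = ℤ.*-identityˡ (+ L 0)

ehrhartNumCoeff-1 : ∀ d L → ehrhartNumCoeff d L 1 ≡ + L 1 - + ℕ.suc d * + L 0
ehrhartNumCoeff-1 d L = cong₂ _+_ (ℤ.*-identityˡ (+ L 1)) (begin
  -1ℤ * + (ℕ.suc d C 1) * + L 0    ≡⟨ cong (λ t → -1ℤ * + t * + L 0) (nC1≡n (ℕ.suc d)) ⟩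
  -1ℤ * + ℕ.suc d * + L 0          ≡⟨ ℤ.*-assoc -1ℤ (+ ℕ.suc d) (+ L 0) ⟩
  -1ℤ * (+ ℕ.suc d * + L 0)        ≡⟨ ℤ.-1*i≡-i _ ⟩
  ℤ.- (+ ℕ.suc d * + L 0)          ∎)
  where open ≡-Reasoning

gamma₁-from-counts : ∀ D (L : ℕ → ℕ) hstar γ →
  (∀ m → coeff hstar m ≡ ehrhartNumCoeff D L m) →
  (∀ m → coeff hstar m ≡ gammaExpandCoeff D γ m) →
  coeff γ 1 ≡ + L 1 - + ℕ.suc D * + L 0 - + L 0 * + D
gamma₁-from-counts D L hstar γ h≡ehr h≡γ = begin
  coeff γ 1                                         ≡⟨ solve 2 (λ a b → b := a :+ b :- a) refl (coeff γ 0 * + D) (coeff γ 1) ⟩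
  coeff γ 0 * + D + coeff γ 1 - coeff γ 0 * + D     ≡⟨ cong₂ (λ a b → a - b * + D) h₁ γ₀ ⟩
  + L 1 - + ℕ.suc D * + L 0 - + L 0 * + D           ∎
  where
  open ≡-Reasoning
  γ₀ : coeff γ 0 ≡ + L 0
  γ₀ = trans (sym (gammaExpandCoeff-0 D γ)) (trans (sym (h≡γ 0)) (trans (h≡ehr 0) (ehrhartNumCoeff-0 D L)))
  h₁ : coeff γ 0 * + D + coeff γ 1 ≡ + L 1 - + ℕ.suc D * + L 0
  h₁ = trans (sym (gammaExpandCoeff-1 D γ)) (trans (sym (h≡γ 1)) (trans (h≡ehr 1) (ehrhartNumCoeff-1 D L)))

gamma₁-value : ∀ d E → + (1 ℕ.+ 2 ℕ.* E) - + ℕ.suc d * + 1 - + 1 * + d ≡ + 2 * ((+ E - + ℕ.suc d) + + 1)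
gamma₁-value d E = begin
  + (1 ℕ.+ 2 ℕ.* E) - + ℕ.suc d * + 1 - + 1 * + d    ≡⟨ cong₂ (λ a b → a - b * + 1 - + 1 * + d) 1+2E (ℤ.pos-+ 1 d) ⟩
  (+ 1 + + 2 * + E) - (+ 1 + + d) * + 1 - + 1 * + d  ≡⟨ solve 2 (λ e y → (con (+ 1) :+ con (+ 2) :* e) :- (con (+ 1) :+ y) :* con (+ 1) :- con (+ 1) :* y
                                                                   := con (+ 2) :* ((e :- (con (+ 1) :+ y)) :+ con (+ 1))) refl (+ E) (+ d) ⟩
  + 2 * ((+ E - (+ 1 + + d)) + + 1)                  ≡⟨ cong (λ s → + 2 * ((+ E - s) + + 1)) (ℤ.pos-+ 1 d) ⟨
  + 2 * ((+ E - + ℕ.suc d) + + 1)                    ∎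
  where
  open ≡-Reasoning
  1+2E : + (1 ℕ.+ 2 ℕ.* E) ≡ + 1 + + 2 * + E
  1+2E = trans (ℤ.pos-+ 1 (2 ℕ.* E)) (cong (_+_ 1ℤ) (ℤ.pos-* 2 E))

theorem4p1 : (n : ℕ) → 1 ≤ n → (G : Graph n) → Connected G →
    (L : ℕ → ℕ) → (∀ k → LatticeCount (sepGenerators G) k (L k)) →
    (hstar : List ℤ) →
    (∀ m → coeff hstar m ≡ ehrhartNumCoeff (n ∸ 1) L m) →
    (γ : List ℤ) → length γ ≡ ℕ.suc ((n ∸ 1) / 2) →
    (∀ m → coeff hstar m ≡ gammaExpandCoeff (n ∸ 1) γ m) →
    coeff γ 1 ≡ (+ 2) * (((+ (length (edges G))) - (+ n)) + (+ 1))
theorem4p1 ℕ.zero ()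
theorem4p1 (ℕ.suc d) _ G _ L counts hstar h≡ehr γ _ h≡γ = begin
  coeff γ 1                                            ≡⟨ gamma₁-from-counts d L hstar γ h≡ehr h≡γ ⟩
  + L 1 - + ℕ.suc d * + L 0 - + L 0 * + d              ≡⟨ cong₂ (λ a b → + a - + ℕ.suc d * + b - + b * + d) L₁ L₀ ⟩
  + (1 ℕ.+ 2 ℕ.* E) - + ℕ.suc d * + 1 - + 1 * + d      ≡⟨ gamma₁-value d E ⟩
  + 2 * ((+ E - + ℕ.suc d) + + 1)                      ∎
  where
  open ≡-Reasoning
  E : ℕ
  E = length (edges G)
  L₀ : L 0 ≡ 1
  L₀ = latticeCount-zero (counts 0)
  L₁ : L 1 ≡ 1 ℕ.+ 2 ℕ.* E
  L₁ = latticeCount-one G (counts 1)
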